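{- Let $k\ge 2$. Suppose $G$ and $H$ are finite abelian groups with $H=G\times G'$ for some finite abelian group $G'$ and $\exp(G)=\exp(H)$. Then $f^{(D)}_G(k)\le f^{(D)}_H(k)$. In particular, for a prime $p$, if $G_n=(\mathbb{Z}_p)^n$ and $f_n:=f^{(D)}_{G_n}(k)$, then the sequence $\{f_n\}_{n\ge1}$ is (weakly) increasing.
   Context: For a finite abelian group $G$ (written additively) and a non-empty set $A\subseteq\mathbb{Z}\setminus\{0\}$, the weighted Davenport constant $D_A(G)$ is the least positive integer $k$ such that for every sequence $(x_1,\ldots,x_k)$ of elements of $G$ there exist a non-empty subsequence $(x_{i_1},\ldots,x_{i_t})$ and elements $a_1,\ldots,a_t\in A$ with $\sum_{j=1}^t a_jx_{i_j}=0$. For $G$ of exponent $n$ and an integer $k\ge 2$, $f^{(D)}_G(k):=\min\{|A|:\emptyset\ne A\subseteq[1,n-1],\ D_A(G)\le k\}$, with value $\infty$ if no such $A$ exists. -}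

module Defs where

open import Level using (Level; _⊔_) renaming (suc to lsuc)
open import Data.Nat as ℕ using (ℕ; zero; suc; _≤_)
open import Data.Integer as ℤ using (ℤ; +_; -_; _-_)
open import Data.Integer.Properties as ℤP using ()
open import Data.Integer.Tactic.RingSolver using (solve-∀)
open import Data.Fin using (Fin; toℕ)
open import Data.Fin.Subset using (Subset; _∈_; _∉_; Nonempty; ∣_∣)
open import Data.Vec using (lookup)
open import Data.Bool using (if_then_else_)
open import Data.List using (List)
open import Data.List.Relation.Unary.Any using (Any)
open import Data.Product using (Σ; ∃; ∃-syntax; _×_; _,_)
open import Relation.Binary.PropositionalEquality as ≡ using (_≡_; refl; cong; cong₂)
open import Algebra.Bundles using (AbelianGroup)
import Algebra.Construct.DirectProduct as DP
import Algebra.Construct.Zero as Z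

record FinAbGroup (c ℓ : Level) : Set (lsuc (c ⊔ ℓ)) where
  field
    group    : AbelianGroup c ℓ
  open AbelianGroup group public hiding (group)
  field
    elements : List Carrier
    complete : ∀ x → Any (x ≈_) elements

module _ {c ℓ : Level} (G : AbelianGroup c ℓ) where
  open AbelianGroup G

  mul : ℕ → Carrier → Carrier
  mul zero    x = ε
  mul (suc m) x = x ∙ mul m x

  sumFin : (k : ℕ) → (Fin k → Carrier) → Carrier
  sumFin zero    f = ε
  sumFin (suc k) f = f Fin.zero ∙ sumFin k (λ i → f (Fin.suc i))
    where import Data.Fin as Fin

  IsExponent : ℕ → Set (c ⊔ ℓ)
  IsExponent n = (1 ≤ n) × (∀ x → mul n x ≈ ε)
               × (∀ m → 1 ≤ m → (∀ x → mul m x ≈ ε) → n ≤ m)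

  -- Weight sets A ⊆ [0, n-1] are represented as subsets of Fin n, the
  -- element i ∈ Fin n standing for the integer toℕ i.

  HasAZeroSum : {n : ℕ} → Subset n → (k : ℕ) → (Fin k → Carrier) → Set ℓ
  HasAZeroSum {n} A k x =
    Σ (Subset k) λ S → Nonempty S × Σ (Fin k → Fin n) λ a → (∀ i → i ∈ S → a i ∈ A) ×
      (sumFin k (λ i → if lookup S i then mul (toℕ {n} (a i)) (x i) else ε) ≈ ε)

  -- D_A(G) ≤ k : the least positive integer j such that every sequence of
  -- length j has an A-weighted zero-sum subsequence is at most k, i.e.
  -- some j with 1 ≤ j ≤ k has this property.
  DavenportLe : {n : ℕ} → Subset n → ℕ → Set (c ⊔ ℓ)
  DavenportLe A k = Σ ℕ λ j → (1 ≤ j) × (j ≤ k) × (∀ (x : Fin j → Carrier) → HasAZeroSum A j x)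

  -- A is admissible in the definition of f^{(D)}_G(k) (G of exponent n):
  -- ∅ ≠ A ⊆ [1, n-1] and D_A(G) ≤ k.
  Admissible : (n : ℕ) → Subset n → ℕ → Set (c ⊔ ℓ)
  Admissible n A k = Nonempty A × (∀ i → i ∈ A → 1 ≤ toℕ i) × DavenportLe A k

-- f^{(D)}_G(k) ≤ f^{(D)}_H(k) where both G and H have exponent n, with the
-- convention min ∅ = ∞: every admissible A for H is matched by an
-- admissible A' for G of no larger cardinality.
fD-≤ : {c₁ ℓ₁ c₂ ℓ₂ : Level} → AbelianGroup c₁ ℓ₁ → AbelianGroup c₂ ℓ₂ →
       (n k : ℕ) → Set (c₁ ⊔ ℓ₁ ⊔ c₂ ⊔ ℓ₂)
fD-≤ G H n k = ∀ (A : Subset n) → Admissible H n A k →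
               Σ (Subset n) λ A′ → Admissible G n A′ k × (∣ A′ ∣ ≤ ∣ A ∣)

-- The cyclic group ℤ_p = ℤ / pℤ, as ℤ with equality "congruent mod p".

module Cyclic (p : ℕ) where
  P : ℤ
  P = + p

  _≈p_ : ℤ → ℤ → Set
  x ≈p y = ∃[ q ] (x - y ≡ q ℤ.* P)

  private
    fromEq : ∀ {x y} → x ≡ y → x ≈p y
    fromEq {x} refl = + 0 , lem x
      where lem : ∀ x → x - x ≡ + 0 ℤ.* P
            lem x = ≡.trans (ℤP.+-inverseʳ x) (≡.sym (ℤP.*-zeroˡ P))

    symm : ∀ {x y} → x ≈p y → y ≈p x
    symm {x} {y} (q , e) = - q , (begin
        y - x          ≡⟨ ≡.sym (ℤP.neg-involutive (y - x)) ⟩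
        - - (y - x)    ≡⟨ cong -_ (l x y) ⟩
        - (x - y)      ≡⟨ cong -_ e ⟩
        - (q ℤ.* P)    ≡⟨ ℤP.neg-distribˡ-* q P ⟩
        - q ℤ.* P      ∎)
      where
        open ≡.≡-Reasoning
        l : ∀ x y → - (y - x) ≡ x - y
        l = solve-∀

    tran : ∀ {x y z} → x ≈p y → y ≈p z → x ≈p z
    tran {x} {y} {z} (q , e) (r , f) = q ℤ.+ r , (begin
        x - z                 ≡⟨ l x y z ⟩
        (x - y) ℤ.+ (y - z)   ≡⟨ cong₂ ℤ._+_ e f ⟩
        q ℤ.* P ℤ.+ r ℤ.* P   ≡⟨ ≡.sym (ℤP.*-distribʳ-+ P q r) ⟩
        (q ℤ.+ r) ℤ.* P       ∎)
      where
        open ≡.≡-Reasoning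
        l : ∀ x y z → x - z ≡ (x - y) ℤ.+ (y - z)
        l = solve-∀

    +cong : ∀ {x y u v} → x ≈p y → u ≈p v → (x ℤ.+ u) ≈p (y ℤ.+ v)
    +cong {x} {y} {u} {v} (q , e) (r , f) = q ℤ.+ r , (begin
        (x ℤ.+ u) - (y ℤ.+ v) ≡⟨ l x y u v ⟩
        (x - y) ℤ.+ (u - v)   ≡⟨ cong₂ ℤ._+_ e f ⟩
        q ℤ.* P ℤ.+ r ℤ.* P   ≡⟨ ≡.sym (ℤP.*-distribʳ-+ P q r) ⟩
        (q ℤ.+ r) ℤ.* P       ∎)
      where
        open ≡.≡-Reasoning
        l : ∀ x y u v → (x ℤ.+ u) - (y ℤ.+ v) ≡ (x - y) ℤ.+ (u - v)
        l = solve-∀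

    negcong : ∀ {x y} → x ≈p y → (- x) ≈p (- y)
    negcong {x} {y} (q , e) = - q , (begin
        (- x) - (- y)  ≡⟨ l x y ⟩
        - (x - y)      ≡⟨ cong -_ e ⟩
        - (q ℤ.* P)    ≡⟨ ℤP.neg-distribˡ-* q P ⟩
        - q ℤ.* P      ∎)
      where
        open ≡.≡-Reasoning
        l : ∀ x y → (- x) - (- y) ≡ - (x - y)
        l = solve-∀

  ℤ/p : AbelianGroup Level.zero Level.zero
  ℤ/p = record
    { Carrier = ℤ ; _≈_ = _≈p_ ; _∙_ = ℤ._+_ ; ε = + 0 ; _⁻¹ = -_
    ; isAbelianGroup = record
      { isGroup = record
        { isMonoid = record
          { isSemigroup = record
            { isMagma = record
              { isEquivalence = record { refl = λ {x} → fromEq {x} refl ; sym = λ {x} {y} → symm {x} {y} ; trans = λ {x} {y} {z} → tran {x} {y} {z} }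
              ; ∙-cong = λ {x} {y} {u} {v} → +cong {x} {y} {u} {v} }
            ; assoc = λ x y z → fromEq (ℤP.+-assoc x y z) }
          ; identity = (λ x → fromEq (ℤP.+-identityˡ x)) , (λ x → fromEq (ℤP.+-identityʳ x)) }
        ; inverse = (λ x → fromEq (ℤP.+-inverseˡ x)) , (λ x → fromEq (ℤP.+-inverseʳ x))
        ; ⁻¹-cong = λ {x} {y} → negcong {x} {y} }
      ; comm = λ x y → fromEq (ℤP.+-comm x y) } }

ℤpPow : (p n : ℕ) → AbelianGroup Level.zero Level.zero
ℤpPow p zero    = Z.abelianGroup
ℤpPow p (suc n) = DP.abelianGroup (Cyclic.ℤ/p p) (ℤpPow p n)

module Submission where

-- The weighted Davenport condition only gets weaker when a group
-- is replaced by a retract of it.  Suppose G is a retract of H: there is a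
-- group homomorphism π : H → G together with a map of sets ι : G → H with
-- π ∘ ι = id.  Given a sequence x in G, push it into H as ι ∘ x.  An
-- A-weighted zero-sum subsequence of ι ∘ x in H is mapped by π, which commutes
-- with multiples and finite sums, to an A-weighted zero-sum subsequence of x
-- with the same positions and weights.  Hence every weight set A admissible
-- for H (with D_A(H) ≤ k) is admissible for G, so f^{(D)}_G(k) ≤ f^{(D)}_H(k),
-- witnessed by the same set A.

open import Defs
open import Level using (Level)
open import Data.Nat using (ℕ; zero; suc; _≤_)
open import Data.Nat.Properties using (≤-refl)
open import Data.Nat.Primality using (Prime)
open import Data.Bool using (Bool; true; false; if_then_else_)
open import Data.Fin using (Fin; toℕ)
import Data.Fin as Fin
open import Data.Fin.Subset using (Subset)
open import Data.Vec using (lookup)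
open import Data.Product using (_×_; _,_; proj₁; proj₂)
open import Algebra.Bundles using (AbelianGroup)
open import Algebra.Construct.DirectProduct using (abelianGroup)
import Relation.Binary.Reasoning.Setoid as SetoidReasoning

record Homomorphism {c₁ ℓ₁ c₂ ℓ₂ : Level}
    (H : AbelianGroup c₂ ℓ₂) (G : AbelianGroup c₁ ℓ₁) : Set (c₁ Level.⊔ ℓ₁ Level.⊔ c₂ Level.⊔ ℓ₂) where
  private
    module G = AbelianGroup G
    module H = AbelianGroup H
  field
    ⟦_⟧  : H.Carrier → G.Carrier
    cong : ∀ {a b} → a H.≈ b → ⟦ a ⟧ G.≈ ⟦ b ⟧
    ε-↦  : ⟦ H.ε ⟧ G.≈ G.ε
    ∙-↦  : ∀ a b → ⟦ a H.∙ b ⟧ G.≈ ⟦ a ⟧ G.∙ ⟦ b ⟧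

sumFin-cong : {c ℓ : Level} (G : AbelianGroup c ℓ) (k : ℕ) {f g : Fin k → AbelianGroup.Carrier G} →
  (∀ i → AbelianGroup._≈_ G (f i) (g i)) → AbelianGroup._≈_ G (sumFin G k f) (sumFin G k g)
sumFin-cong G zero    f≈g = AbelianGroup.refl G
sumFin-cong G (suc k) f≈g = AbelianGroup.∙-cong G (f≈g Fin.zero) (sumFin-cong G k (λ i → f≈g (Fin.suc i)))

mul-cong : {c ℓ : Level} (G : AbelianGroup c ℓ) (m : ℕ) {x y : AbelianGroup.Carrier G} →
  AbelianGroup._≈_ G x y → AbelianGroup._≈_ G (mul G m x) (mul G m y)
mul-cong G zero    x≈y = AbelianGroup.refl G
mul-cong G (suc m) x≈y = AbelianGroup.∙-cong G x≈y (mul-cong G m x≈y)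

module HomomorphismProperties {c₁ ℓ₁ c₂ ℓ₂ : Level} {H : AbelianGroup c₂ ℓ₂} {G : AbelianGroup c₁ ℓ₁}
    (π : Homomorphism H G) where
  private
    module G = AbelianGroup G
    module H = AbelianGroup H
  open Homomorphism π

  mul-↦ : ∀ m x → ⟦ mul H m x ⟧ G.≈ mul G m ⟦ x ⟧
  mul-↦ zero    x = ε-↦
  mul-↦ (suc m) x = G.trans (∙-↦ x (mul H m x)) (G.∙-cong G.refl (mul-↦ m x))

  sumFin-↦ : ∀ k (f : Fin k → H.Carrier) → ⟦ sumFin H k f ⟧ G.≈ sumFin G k (λ i → ⟦ f i ⟧)
  sumFin-↦ zero    f = ε-↦
  sumFin-↦ (suc k) f = G.trans (∙-↦ _ _) (G.∙-cong G.refl (sumFin-↦ k (λ i → f (Fin.suc i))))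

record Retract {c₁ ℓ₁ c₂ ℓ₂ : Level}
    (G : AbelianGroup c₁ ℓ₁) (H : AbelianGroup c₂ ℓ₂) : Set (c₁ Level.⊔ ℓ₁ Level.⊔ c₂ Level.⊔ ℓ₂) where
  field
    projection : Homomorphism H G
    section    : AbelianGroup.Carrier G → AbelianGroup.Carrier H
  open Homomorphism projection public
  field
    retraction : ∀ x → AbelianGroup._≈_ G ⟦ section x ⟧ x

module RetractTransfer {c₁ ℓ₁ c₂ ℓ₂ : Level} {G : AbelianGroup c₁ ℓ₁} {H : AbelianGroup c₂ ℓ₂}
    (R : Retract G H) {n : ℕ} (A : Subset n) where
  private
    module G = AbelianGroup G
    module H = AbelianGroup H
  open Retract R
  open HomomorphismProperties projection
  open SetoidReasoning G.setoid

  summand-↦ : (b : Bool) (a : Fin n) (x : G.Carrier) →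
    ⟦ if b then mul H (toℕ a) (section x) else H.ε ⟧ G.≈ (if b then mul G (toℕ a) x else G.ε)
  summand-↦ true  a x = G.trans (mul-↦ (toℕ a) (section x)) (mul-cong G (toℕ a) (retraction x))
  summand-↦ false a x = ε-↦

  zeroSum-transfer : ∀ j (x : Fin j → G.Carrier) →
    HasAZeroSum H A j (λ i → section (x i)) → HasAZeroSum G A j x
  zeroSum-transfer j x (S , S≢∅ , a , a∈A , sum≈ε) = S , S≢∅ , a , a∈A , (begin
      sumFin G j (λ i → if lookup S i then mul G (toℕ (a i)) (x i) else G.ε)
        ≈⟨ sumFin-cong G j (λ i → summand-↦ (lookup S i) (a i) (x i)) ⟨
      sumFin G j (λ i → ⟦ if lookup S i then mul H (toℕ (a i)) (section (x i)) else H.ε ⟧)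
        ≈⟨ sumFin-↦ j _ ⟨
      ⟦ sumFin H j (λ i → if lookup S i then mul H (toℕ (a i)) (section (x i)) else H.ε) ⟧
        ≈⟨ cong sum≈ε ⟩
      ⟦ H.ε ⟧
        ≈⟨ ε-↦ ⟩
      G.ε ∎)

  davenport-transfer : ∀ k → DavenportLe H A k → DavenportLe G A k
  davenport-transfer k (j , 1≤j , j≤k , zeroSums) =
    j , 1≤j , j≤k , λ x → zeroSum-transfer j x (zeroSums (λ i → section (x i)))

  admissible-transfer : ∀ k → Admissible H n A k → Admissible G n A k
  admissible-transfer k (A≢∅ , positive , D≤k) = A≢∅ , positive , davenport-transfer k D≤k

fD-≤-retract : {c₁ ℓ₁ c₂ ℓ₂ : Level} {G : AbelianGroup c₁ ℓ₁} {H : AbelianGroup c₂ ℓ₂} →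
  Retract G H → (n k : ℕ) → fD-≤ G H n k
fD-≤-retract R n k A admissible = A , RetractTransfer.admissible-transfer R A k admissible , ≤-refl

retract-proj₁ : {c₁ ℓ₁ c₂ ℓ₂ : Level} (G : AbelianGroup c₁ ℓ₁) (G′ : AbelianGroup c₂ ℓ₂) →
  Retract G (abelianGroup G G′)
retract-proj₁ G G′ = record
  { projection = record { ⟦_⟧ = proj₁ ; cong = proj₁ ; ε-↦ = G.refl ; ∙-↦ = λ _ _ → G.refl }
  ; section    = λ x → x , AbelianGroup.ε G′
  ; retraction = λ _ → G.refl
  }
  where module G = AbelianGroup G

retract-proj₂ : {c₁ ℓ₁ c₂ ℓ₂ : Level} (G′ : AbelianGroup c₁ ℓ₁) (G : AbelianGroup c₂ ℓ₂) →
  Retract G (abelianGroup G′ G)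
retract-proj₂ G′ G = record
  { projection = record { ⟦_⟧ = proj₂ ; cong = proj₂ ; ε-↦ = G.refl ; ∙-↦ = λ _ _ → G.refl }
  ; section    = λ x → AbelianGroup.ε G′ , x
  ; retraction = λ _ → G.refl
  }
  where module G = AbelianGroup G

proposition2 : {c₁ ℓ₁ c₂ ℓ₂ : Level} →
    ((k : ℕ) → 2 ≤ k → (G : FinAbGroup c₁ ℓ₁) (G′ : FinAbGroup c₂ ℓ₂) → (n : ℕ) →
      IsExponent (FinAbGroup.group G) n →
      IsExponent (abelianGroup (FinAbGroup.group G) (FinAbGroup.group G′)) n →
      fD-≤ (FinAbGroup.group G) (abelianGroup (FinAbGroup.group G) (FinAbGroup.group G′)) n k)
    ×
    ((k : ℕ) → 2 ≤ k → (p : ℕ) → Prime p → (n : ℕ) → 1 ≤ n →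
      fD-≤ (ℤpPow p n) (ℤpPow p (suc n)) p k)
proposition2 =
  (λ k _ G G′ n _ _ → fD-≤-retract (retract-proj₁ (FinAbGroup.group G) (FinAbGroup.group G′)) n k) ,
  (λ k _ p _ n _ → fD-≤-retract (retract-proj₂ (Cyclic.ℤ/p p) (ℤpPow p n)) p k)
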